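{- Let $t$ be a good $\mathbb F$-term with $k$ variables $y_1,\ldots,y_k$ such that $[\![t]\!]=f:A_{i_1}\times\cdots\times A_{i_k}\to A_q$, and let $N$ be the number of nodes of the tree of the composition of functions of $\mathbb F$ giving $f$. Then there exists $L_t=O(N)$ such that for every $(a_1,\ldots,a_k)\in A_{i_1}\times\cdots\times A_{i_k}$, $t[\ulcorner a_1\urcorner/y_1,\ldots,\ulcorner a_k\urcorner/y_k]\twoheadrightarrow_{\mathbb F}\ulcorner f(a_1,\ldots,a_k)\urcorner$, and, using the leftmost reduction strategy, this sequence of reductions consists of exactly $L_t$ $\mathbb F$-reductions.
   Context: $\mathbb F$ is a family of functions over datatypes $A_1,\ldots,A_n$, each element $a$ coded by a closed normal $\lambda$-term $\ulcorner a\urcorner$. $\Lambda_{\mathbb F}$-terms are built from variables and constants $c_f$ ($f\in\mathbb F$) by abstraction and application; $\mathbb F$-reduction ($\to_{\mathbb F}$) is given by the axioms $c_f\,\ulcorner a_1\urcorner\cdots\ulcorner a_k\urcorner\to\ulcorner f(a_1,\ldots,a_k)\urcorner$ applied to any subterm, and $\twoheadrightarrow_{\mathbb F}$ is its reflexive transitive closure. Pattern $\mathbb F$-terms: using typed variables $x^{A_i}_j$, if $f\in\mathbb F$ has type $A_{i_1}\times\cdots\times A_{i_k}\to A_q$ and each $t_j$ is either a typed variable of type $A_{i_j}$ or a pattern $\mathbb F$-term with value type $A_{i_j}$, then $c_f\,t_1\cdots t_k$ is a pattern $\mathbb F$-term with value type $A_q$; its semantics $[\![c_f t_1\cdots t_k]\!]$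 is the function of its variables given by $f([\![t_1]\!],\ldots,[\![t_k]\!])$ (a variable denoting the identity on its argument). Good $\mathbb F$-terms are obtained from pattern $\mathbb F$-terms by substituting untyped variables for typed ones, distinct typed variables by distinct untyped variables; the semantics is inherited. The composition tree of $f$ is the tree of this term with internal nodes labeled by functions of $\mathbb F$ and leaves by variables. The leftmost strategy reduces the leftmost $\mathbb F$-redex. -}

module Defs where

open import Data.Nat using (ℕ; zero; suc; _<_; _+_)
open import Data.Fin using (Fin; toℕ)
open import Data.List using (List; []; _∷_)
open import Data.List.Relation.Unary.All using (All; []; _∷_; lookup)
open import Data.List.Relation.Unary.Any using (index)
open import Data.List.Membership.Propositional using (_∈_)
open import Data.Empty using (⊥)
open import Data.Unit using (⊤)
open import Data.Product using (∃)
open import Relation.Nullary using (¬_)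
open import Relation.Binary.Construct.Closure.ReflexiveTransitive using (Star)

-- λ-terms (de Bruijn) with constants drawn from S.
-- Pure λ-terms are Λ ⊥ (no constants).

data Λ (S : Set) : Set where
  var : ℕ → Λ S
  con : S → Λ S
  lam : Λ S → Λ S
  app : Λ S → Λ S → Λ S

data Scoped {S : Set} : ℕ → Λ S → Set where
  var : ∀ {k x} → x < k → Scoped k (var x)
  con : ∀ {k c} → Scoped k (con c)
  lam : ∀ {k M} → Scoped (suc k) M → Scoped k (lam M)
  app : ∀ {k M N} → Scoped k M → Scoped k N → Scoped k (app M N)

Closed : ∀ {S : Set} → Λ S → Set
Closed = Scoped 0

mutual
  data Nf : Λ ⊥ → Set where
    lam : ∀ {M} → Nf M → Nf (lam M)
    ne  : ∀ {M} → Ne M → Nf M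

  data Ne : Λ ⊥ → Set where
    var : ∀ x → Ne (var x)
    app : ∀ {M N} → Ne M → Nf N → Ne (app M N)

embed : ∀ {S : Set} → Λ ⊥ → Λ S
embed (var x) = var x
embed (con ())
embed (lam M) = lam (embed M)
embed (app M N) = app (embed M) (embed N)

rename : ∀ {S : Set} → (ℕ → ℕ) → Λ S → Λ S
rename ρ (var x) = var (ρ x)
rename ρ (con c) = con c
rename ρ (lam M) = lam (rename (λ { zero → zero ; (suc x) → suc (ρ x) }) M)
rename ρ (app M N) = app (rename ρ M) (rename ρ N)

lift : ∀ {S : Set} → (ℕ → Λ S) → ℕ → Λ S
lift σ zero = var zero
lift σ (suc x) = rename suc (σ x)

subst : ∀ {S : Set} → (ℕ → Λ S) → Λ S → Λ S
subst σ (var x) = σ x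
subst σ (con c) = con c
subst σ (lam M) = lam (subst (lift σ) M)
subst σ (app M N) = app (subst σ M) (subst σ N)

spine : ∀ {S : Set} → Λ S → List (Λ S) → Λ S
spine M [] = M
spine M (N ∷ Ns) = spine (app M N) Ns

record Datatypes : Set₁ where
  field
    n : ℕ
    A : Fin n → Set
    code : ∀ {i} → A i → Λ ⊥
    code-closed : ∀ {i} (a : A i) → Closed (code a)
    code-normal : ∀ {i} (a : A i) → Nf (code a)

record Family (D : Datatypes) : Set₁ where
  open Datatypes D
  field
    Sym : Set
    dom : Sym → List (Fin n)
    cod : Sym → Fin n
    sem : (f : Sym) → All A (dom f) → A (cod f)

module Theory {D : Datatypes} (F : Family D) where
  open Datatypes D public
  open Family F public

  Tm : Set
  Tm = Λ Sym

  ⌜_⌝ : ∀ {i} → A i → Tm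
  ⌜ a ⌝ = embed (code a)

  codes : ∀ {is} → All A is → List Tm
  codes [] = []
  codes (a ∷ as) = ⌜ a ⌝ ∷ codes as

  data Redex : Tm → Tm → Set where
    ax : (f : Sym) (as : All A (dom f)) →
         Redex (spine (con f) (codes as)) ⌜ sem f as ⌝

  data _⟶F_ : Tm → Tm → Set where
    red  : ∀ {M M'} → Redex M M' → M ⟶F M'
    appL : ∀ {M M' N} → M ⟶F M' → app M N ⟶F app M' N
    appR : ∀ {M N N'} → N ⟶F N' → app M N ⟶F app M N'
    lam  : ∀ {M M'} → M ⟶F M' → lam M ⟶F lam M'

  infix 4 _↠F_ _⟶F_ _⟶ₗ_
  _↠F_ : Tm → Tm → Set
  _↠F_ = Star _⟶F_

  IsRedex : Tm → Set
  IsRedex M = ∃ (Redex M)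

  NormalF : Tm → Set
  NormalF M = ∀ M' → ¬ (M ⟶F M')

  data _⟶ₗ_ : Tm → Tm → Set where
    red  : ∀ {M M'} → Redex M M' → M ⟶ₗ M'
    appL : ∀ {M M' N} → ¬ IsRedex (app M N) → M ⟶ₗ M' → app M N ⟶ₗ app M' N
    appR : ∀ {M N N'} → ¬ IsRedex (app M N) → NormalF M → N ⟶ₗ N' →
           app M N ⟶ₗ app M N'
    lam  : ∀ {M M'} → M ⟶ₗ M' → lam M ⟶ₗ lam M'

  data Leftmost : ℕ → Tm → Tm → Set where
    done : ∀ {M} → Leftmost 0 M M
    step : ∀ {L M M' M''} → M ⟶ₗ M' → Leftmost L M' M'' → Leftmost (suc L) M M''

  -- Good 𝔽-terms over untyped variables y₁,…,yₖ of types Γ = i₁,…,iₖ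
  -- (variable yⱼ is the position j in Γ, de Bruijn index j).

  mutual
    data Pat (Γ : List (Fin n)) : Fin n → Set where
      node : (f : Sym) → Args Γ (dom f) → Pat Γ (cod f)

    data Arg (Γ : List (Fin n)) (i : Fin n) : Set where
      var : i ∈ Γ → Arg Γ i
      pat : Pat Γ i → Arg Γ i

    data Args (Γ : List (Fin n)) : List (Fin n) → Set where
      []  : Args Γ []
      _∷_ : ∀ {i is} → Arg Γ i → Args Γ is → Args Γ (i ∷ is)

  mutual
    ⌊_⌋ : ∀ {Γ q} → Pat Γ q → Tm
    ⌊ node f ts ⌋ = spine (con f) ⌊ ts ⌋s

    ⌊_⌋a : ∀ {Γ i} → Arg Γ i → Tm
    ⌊ var p ⌋a = var (toℕ (index p))
    ⌊ pat t ⌋a = ⌊ t ⌋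

    ⌊_⌋s : ∀ {Γ is} → Args Γ is → List Tm
    ⌊ [] ⌋s = []
    ⌊ t ∷ ts ⌋s = ⌊ t ⌋a ∷ ⌊ ts ⌋s

  mutual
    ⟦_⟧ : ∀ {Γ q} → Pat Γ q → All A Γ → A q
    ⟦ node f ts ⟧ as = sem f (⟦ ts ⟧s as)

    ⟦_⟧a : ∀ {Γ i} → Arg Γ i → All A Γ → A i
    ⟦ var p ⟧a as = lookup as p
    ⟦ pat t ⟧a as = ⟦ t ⟧ as

    ⟦_⟧s : ∀ {Γ is} → Args Γ is → All A Γ → All A is
    ⟦ [] ⟧s as = []
    ⟦ t ∷ ts ⟧s as = ⟦ t ⟧a as ∷ ⟦ ts ⟧s as

  mutual
    nodes : ∀ {Γ q} → Pat Γ q → ℕ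
    nodes (node f ts) = suc (nodes-s ts)

    nodes-a : ∀ {Γ i} → Arg Γ i → ℕ
    nodes-a (var p) = 1
    nodes-a (pat t) = nodes t

    nodes-s : ∀ {Γ is} → Args Γ is → ℕ
    nodes-s [] = 0
    nodes-s (t ∷ ts) = nodes-a t + nodes-s ts

  env : ∀ {Γ} → All A Γ → ℕ → Tm
  env [] x = var x
  env (a ∷ as) zero = ⌜ a ⌝
  env (a ∷ as) (suc x) = env as x

  infixl 8 _[_]
  _[_] : ∀ {Γ q} → Pat Γ q → All A Γ → Tm
  t [ as ] = subst (env as) ⌊ t ⌋

-- A constant c_f applied to fewer than arity-f 𝔽-normal arguments is 𝔽-normal, and a spine
-- with a reducible argument is not a redex.  Hence the leftmost strategy evaluates the
-- arguments of c_f one after the other, from left to right, down to codes, and then fires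
-- the axiom of f once.  So t[⌜a⌝/y] reaches ⌜⟦t⟧ a⌝ in exactly as many steps as t has
-- function symbols, which is at most its number of nodes N.

module Submission where

open import Defs
open import Data.Nat using (ℕ; suc; _+_; _*_; _≤_; z≤n)
open import Data.Nat.Properties using (suc-injective; 1+n≢0; +-comm; +-monoˡ-≤; +-mono-≤; *-identityˡ; ≤-trans; ≤-reflexive)
open import Data.Fin using (toℕ)
open import Data.List using (List; []; _∷_; map; length)
open import Data.List.Properties using (length-map)
open import Data.List.Relation.Unary.All as All using (All; []; _∷_)
open import Data.List.Relation.Unary.Any using (here; there; index)
open import Data.List.Membership.Propositional using (_∈_)
open import Data.Product using (_×_; _,_; proj₂; ∃-syntax)
open import Data.Empty using (⊥)
open import Relation.Nullary using (¬_)
open import Relation.Binary.PropositionalEquality as Eq using (_≡_; _≢_; refl; sym; trans; cong)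
open import Relation.Binary.Construct.Closure.ReflexiveTransitive using (ε; _◅_)

head : ∀ {S : Set} → Λ S → Λ S
head (app M N) = head M
head M = M

head-spine : ∀ {S : Set} (M : Λ S) Ns → head (spine M Ns) ≡ head M
head-spine M [] = refl
head-spine M (N ∷ Ns) = head-spine (app M N) Ns

head-embed≢con : ∀ {S : Set} (M : Λ ⊥) {c : S} → head (embed M) ≢ con c
head-embed≢con (var x) ()
head-embed≢con (con ())
head-embed≢con (lam M) ()
head-embed≢con (app M N) = head-embed≢con M

subst-spine : ∀ {S : Set} (σ : ℕ → Λ S) M Ns →
              subst σ (spine M Ns) ≡ spine (subst σ M) (map (subst σ) Ns)
subst-spine σ M [] = refl
subst-spine σ M (N ∷ Ns) = subst-spine σ (app M N) Ns

module Evaluation {D : Datatypes} (F : Family D) where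
  open Theory F

  redex-head : ∀ {T T'} → Redex T T' → ∃[ f ] head T ≡ con f
  redex-head (ax f as) = f , head-spine (con f) (codes as)

  embed-normalF : ∀ M → NormalF (embed M)
  embed-normalF (lam M) _ (lam s) = embed-normalF M _ s
  embed-normalF (app M N) _ (appL s) = embed-normalF M _ s
  embed-normalF (app M N) _ (appR s) = embed-normalF N _ s
  embed-normalF (con ())
  embed-normalF M _ (red r) = head-embed≢con M (proj₂ (redex-head r))

  codes-normalF : ∀ {is} (as : All A is) → All NormalF (codes as)
  codes-normalF [] = []
  codes-normalF (a ∷ as) = embed-normalF (code a) ∷ codes-normalF as

  ⟶ₗ⇒⟶F : ∀ {M M'} → M ⟶ₗ M' → M ⟶F M'
  ⟶ₗ⇒⟶F (red r) = red r
  ⟶ₗ⇒⟶F (appL _ s) = appL (⟶ₗ⇒⟶F s)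
  ⟶ₗ⇒⟶F (appR _ _ s) = appR (⟶ₗ⇒⟶F s)
  ⟶ₗ⇒⟶F (lam s) = lam (⟶ₗ⇒⟶F s)

  Leftmost⇒↠F : ∀ {L M M'} → Leftmost L M M' → M ↠F M'
  Leftmost⇒↠F done = ε
  Leftmost⇒↠F (step s l) = ⟶ₗ⇒⟶F s ◅ Leftmost⇒↠F l

  Leftmost-trans : ∀ {L L' M M' M''} → Leftmost L M M' → Leftmost L' M' M'' → Leftmost (L + L') M M''
  Leftmost-trans done l' = l'
  Leftmost-trans (step s l) l' = step s (Leftmost-trans l l')

  Leftmost-cong : ∀ (C : Tm → Tm) → (∀ {N N'} → N ⟶ₗ N' → C N ⟶ₗ C N') →
                  ∀ {L N N'} → Leftmost L N N' → Leftmost L (C N) (C N')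
  Leftmost-cong C cong-step done = done
  Leftmost-cong C cong-step (step s l) = step (cong-step s) (Leftmost-cong C cong-step l)

  -- PartialApp k S: S is c_f N₁ ⋯ Nⱼ with every Nᵢ 𝔽-normal and k = arity f − j.
  data PartialApp : ℕ → Tm → Set where
    con : ∀ f → PartialApp (length (dom f)) (con f)
    app : ∀ {k S N} → PartialApp (suc k) S → NormalF N → PartialApp k (app S N)

  data ReducibleArg : Tm → Set where
    here : ∀ {S N N'} → N ⟶F N' → ReducibleArg (app S N)
    app  : ∀ {M N} → ReducibleArg M → ReducibleArg (app M N)

  PartialApp-functional : ∀ {k k' S} → PartialApp k S → PartialApp k' S → k ≡ k'
  PartialApp-functional (con f) (con f) = refl
  PartialApp-functional (app p _) (app p' _) = suc-injective (PartialApp-functional p p')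

  PartialApp-codes : ∀ {is S} (as : All A is) → PartialApp (length is) S →
                     PartialApp 0 (spine S (codes as))
  PartialApp-codes [] p = p
  PartialApp-codes (a ∷ as) p = PartialApp-codes as (app p (embed-normalF (code a)))

  redex-PartialApp : ∀ {T T'} → Redex T T' → PartialApp 0 T
  redex-PartialApp (ax f as) = PartialApp-codes as (con f)

  unsaturated-normalF : ∀ {k S} → PartialApp (suc k) S → NormalF S
  unsaturated-normalF (app p _) _ (appL s) = unsaturated-normalF p _ s
  unsaturated-normalF (app _ n) _ (appR s) = n _ s
  unsaturated-normalF p _ (red r) = 1+n≢0 (PartialApp-functional p (redex-PartialApp r))

  ReducibleArg⇒¬PartialApp : ∀ {k T} → ReducibleArg T → ¬ PartialApp k T
  ReducibleArg⇒¬PartialApp (here s) (app _ n) = n _ s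
  ReducibleArg⇒¬PartialApp (app r) (app p _) = ReducibleArg⇒¬PartialApp r p

  ReducibleArg⇒¬IsRedex : ∀ {T} → ReducibleArg T → ¬ IsRedex T
  ReducibleArg⇒¬IsRedex r (_ , ρ) = ReducibleArg⇒¬PartialApp r (redex-PartialApp ρ)

  spine-⟶ₗ : ∀ {M M'} Ns → ReducibleArg M → M ⟶ₗ M' → spine M Ns ⟶ₗ spine M' Ns
  spine-⟶ₗ [] _ s = s
  spine-⟶ₗ (N ∷ Ns) r s = spine-⟶ₗ Ns (app r) (appL (ReducibleArg⇒¬IsRedex (app r)) s)

  argument-⟶ₗ : ∀ {k S N N'} → PartialApp (suc k) S → N ⟶ₗ N' → app S N ⟶ₗ app S N'
  argument-⟶ₗ p s = appR (ReducibleArg⇒¬IsRedex (here (⟶ₗ⇒⟶F s))) (unsaturated-normalF p) s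

  data Leftmost* : ℕ → List Tm → List Tm → Set where
    []  : Leftmost* 0 [] []
    _∷_ : ∀ {L L' N N' Ns Ns'} → Leftmost L N N' → Leftmost* L' Ns Ns' →
          Leftmost* (L + L') (N ∷ Ns) (N' ∷ Ns')

  arguments-Leftmost : ∀ {L S Ns Ns'} → PartialApp (length Ns) S → Leftmost* L Ns Ns' →
                       All NormalF Ns' → Leftmost L (spine S Ns) (spine S Ns')
  arguments-Leftmost p [] [] = done
  arguments-Leftmost {S = S} {N ∷ Ns} p (l ∷ ls) (n' ∷ ns') =
    Leftmost-trans (Leftmost-cong (λ X → spine (app S X) Ns) argument-step l)
                   (arguments-Leftmost (app p n') ls ns')
    where
    argument-step : ∀ {X X'} → X ⟶ₗ X' → spine (app S X) Ns ⟶ₗ spine (app S X') Ns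
    argument-step s = spine-⟶ₗ Ns (here (⟶ₗ⇒⟶F s)) (argument-⟶ₗ p s)

  mutual
    symbols : ∀ {Γ q} → Pat Γ q → ℕ
    symbols (node f ts) = symbols-s ts + 1

    symbols-a : ∀ {Γ i} → Arg Γ i → ℕ
    symbols-a (var p) = 0
    symbols-a (pat t) = symbols t

    symbols-s : ∀ {Γ is} → Args Γ is → ℕ
    symbols-s [] = 0
    symbols-s (t ∷ ts) = symbols-a t + symbols-s ts

  mutual
    symbols≤nodes : ∀ {Γ q} (t : Pat Γ q) → symbols t ≤ nodes t
    symbols≤nodes (node f ts) =
      ≤-trans (+-monoˡ-≤ 1 (symbols-s≤nodes-s ts)) (≤-reflexive (+-comm (nodes-s ts) 1))

    symbols-a≤nodes-a : ∀ {Γ i} (t : Arg Γ i) → symbols-a t ≤ nodes-a t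
    symbols-a≤nodes-a (var p) = z≤n
    symbols-a≤nodes-a (pat t) = symbols≤nodes t

    symbols-s≤nodes-s : ∀ {Γ is} (ts : Args Γ is) → symbols-s ts ≤ nodes-s ts
    symbols-s≤nodes-s [] = z≤n
    symbols-s≤nodes-s (t ∷ ts) = +-mono-≤ (symbols-a≤nodes-a t) (symbols-s≤nodes-s ts)

  env-lookup : ∀ {Γ i} (as : All A Γ) (p : i ∈ Γ) → env as (toℕ (index p)) ≡ ⌜ All.lookup as p ⌝
  env-lookup (a ∷ as) (here refl) = refl
  env-lookup (a ∷ as) (there p) = env-lookup as p

  length-⌊⌋s : ∀ {Γ is} (ts : Args Γ is) → length ⌊ ts ⌋s ≡ length is
  length-⌊⌋s [] = refl
  length-⌊⌋s (t ∷ ts) = cong suc (length-⌊⌋s ts)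

  mutual
    evaluate : ∀ {Γ q} (t : Pat Γ q) (as : All A Γ) → Leftmost (symbols t) (t [ as ]) ⌜ ⟦ t ⟧ as ⌝
    evaluate (node f ts) as rewrite subst-spine (env as) (con f) ⌊ ts ⌋s =
      Leftmost-trans (arguments-Leftmost unapplied (evaluate-s ts as) (codes-normalF (⟦ ts ⟧s as)))
                     (step (red (ax f (⟦ ts ⟧s as))) done)
      where
      unapplied : PartialApp (length (map (subst (env as)) ⌊ ts ⌋s)) (con f)
      unapplied = Eq.subst (λ k → PartialApp k (con f))
                           (sym (trans (length-map (subst (env as)) ⌊ ts ⌋s) (length-⌊⌋s ts))) (con f)

    evaluate-a : ∀ {Γ i} (t : Arg Γ i) (as : All A Γ) →
                 Leftmost (symbols-a t) (subst (env as) ⌊ t ⌋a) ⌜ ⟦ t ⟧a as ⌝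
    evaluate-a (var p) as rewrite env-lookup as p = done
    evaluate-a (pat t) as = evaluate t as

    evaluate-s : ∀ {Γ is} (ts : Args Γ is) (as : All A Γ) →
                 Leftmost* (symbols-s ts) (map (subst (env as)) ⌊ ts ⌋s) (codes (⟦ ts ⟧s as))
    evaluate-s [] as = []
    evaluate-s (t ∷ ts) as = evaluate-a t as ∷ evaluate-s ts as

proposition3p22 : ∀ {D : Datatypes} (F : Family D) → let open Theory F in
    ∃[ C ] (∀ {Γ q} (t : Pat Γ q) → ∃[ L ] (L ≤ C * nodes t ×
      ∀ (as : All A Γ) →
        (t [ as ] ↠F ⌜ ⟦ t ⟧ as ⌝) × Leftmost L (t [ as ]) ⌜ ⟦ t ⟧ as ⌝))
proposition3p22 F = 1 , λ t →
  symbols t ,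
  ≤-trans (symbols≤nodes t) (≤-reflexive (sym (*-identityˡ _))) ,
  λ as → Leftmost⇒↠F (evaluate t as) , evaluate t as
  where open Evaluation F
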